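{- For every positive integer $n$, $$n!\le\sum_{(\lambda_1,\dots,\lambda_m)\vDash n}\left(\frac{(n-1)!}{\prod_{i=1}^{m-1}\Big(n-\sum_{j=1}^{i}\lambda_j\Big)\cdot\prod_{k=1}^{m}(\lambda_k-1)!}\right)^{2},$$ where the sum runs over all compositions $(\lambda_1,\dots,\lambda_m)$ of $n$.
   Context: A composition of $n$ is a finite sequence of positive integers with sum $n$. Empty products equal $1$. -}

module Defs where

open import Data.Nat using (ℕ; zero; suc; _∸_; _≟_)
open import Data.Nat using (_!)
open import Data.List using (List; []; _∷_; map; concatMap; foldr)
open import Data.Integer using (+_)
open import Data.Rational using (ℚ; 0ℚ; _+_; _*_; _/_)
open import Relation.Nullary using (yes; no)

oneTo : ℕ → List ℕ
oneTo zero    = []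
oneTo (suc n) = go (suc n) 1
  where
  go : ℕ → ℕ → List ℕ
  go zero    k = []
  go (suc c) k = k ∷ go c (suc k)

-- compsF f n : all compositions of n whose number of parts is at most f
-- (sequences of positive integers summing to n), listed by first part.
compsF : ℕ → ℕ → List (List ℕ)
compsF _       zero = [] ∷ []
compsF zero    (suc _) = []
compsF (suc f) n@(suc _) =
  concatMap (λ k → map (k ∷_) (compsF f (n ∸ k))) (oneTo n)

-- all compositions of n (a composition of n has at most n parts)
compositions : ℕ → List (List ℕ)
compositions n = compsF n n

-- natural-number division into ℚ; the denominator is never 0 in use,
-- the zero branch is an irrelevant fallback
_÷ℕ_ : ℕ → ℕ → ℚ
a ÷ℕ zero    = 0ℚ
a ÷ℕ (suc b) = (+ a) / suc b

ℕ→ℚ : ℕ → ℚ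
ℕ→ℚ a = (+ a) / 1

prodℕ : List ℕ → ℕ
prodℕ = foldr Data.Nat._*_ 1

-- ∏_{i=1}^{m-1} (n - (λ_1+...+λ_i)) for the composition λ = (λ_1,...,λ_m) of n:
-- r is the remaining amount n - (λ_1+...+λ_{i-1}); the last part contributes nothing.
tailProd : ℕ → List ℕ → ℕ
tailProd r []           = 1
tailProd r (l ∷ [])     = 1
tailProd r (l ∷ l' ∷ ls) = (r ∸ l) Data.Nat.* tailProd (r ∸ l) (l' ∷ ls)

term : ℕ → List ℕ → ℚ
term n λs = ((n ∸ 1) !) ÷ℕ (tailProd n λs Data.Nat.* prodℕ (map (λ l → (l ∸ 1) !) λs))

sq : ℚ → ℚ
sq q = q * q

sumℚ : List ℚ → ℚ
sumℚ = foldr _+_ 0ℚ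

RHS : ℕ → ℚ
RHS n = sumℚ (map (λ λs → sq (term n λs)) (compositions n))

-- Write S(n) for the sum of squared terms over compositions of n. Deleting a leading part 1
-- from a composition of n leaves the term unchanged, and deleting a leading part 2
-- divides it by n - 1; hence S(n) ≥ S(n-1) + (n-1)² S(n-2). The factorials satisfy this
-- recurrence with equality, n! = (n-1)! + (n-1)² (n-2)!, and agree with S at n = 1, 2.
module Submission where

open import Defs
open import Data.Nat using (ℕ; suc)
open import Data.Nat using (_!)
open import Data.Rational using (_≤_)

open import Data.Nat as ℕ using (zero; s≤s)
import Data.Nat.Properties as ℕ
open import Data.Integer as ℤ using (+_)
import Data.Integer.Properties as ℤ
open import Data.Rational as ℚ using (ℚ; 0ℚ; _+_; _*_; _/_; NonNegative; fromℚᵘ; toℚᵘ)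
import Data.Rational.Properties as ℚ
open import Data.Rational.Unnormalised using (mkℚᵘ; *≡*)
import Data.Rational.Unnormalised.Properties as ℚᵘ
open import Algebra.Bundles using (CommutativeMonoid)
open import Algebra.Properties.CommutativeSemigroup
  (CommutativeMonoid.commutativeSemigroup ℚ.*-1-commutativeMonoid) using (interchange)
open import Data.List using (List; []; _∷_; map; _++_)
open import Data.List.Properties using (map-++)
open import Data.List.Relation.Unary.All using (All; []; _∷_; universal)
open import Data.List.Relation.Unary.All.Properties using (concat⁺; map⁺)
open import Data.Product using (∃-syntax; _,_)
open import Relation.Binary.PropositionalEquality

÷ℕ-cross : ∀ {x y b d} → x ℕ.* suc d ≡ y ℕ.* suc b → x ÷ℕ suc b ≡ y ÷ℕ suc d
÷ℕ-cross {x} {y} {b} {d} eq = ℚ.fromℚᵘ-cong {mkℚᵘ (+ x) b} {mkℚᵘ (+ y) d} (*≡* (begin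
  + x ℤ.* + suc d  ≡⟨ ℤ.pos-* x (suc d) ⟨
  + (x ℕ.* suc d)  ≡⟨ cong +_ eq ⟩
  + (y ℕ.* suc b)  ≡⟨ ℤ.pos-* y (suc b) ⟩
  + y ℤ.* + suc b  ∎))
  where open ≡-Reasoning

÷ℕ-* : ∀ x y b d → (x ÷ℕ suc b) * (y ÷ℕ suc d) ≡ (x ℕ.* y) ÷ℕ (suc b ℕ.* suc d)
÷ℕ-* x y b d = begin
  p * q                                   ≡⟨ ℚ.fromℚᵘ-toℚᵘ (p * q) ⟨
  fromℚᵘ (toℚᵘ (p * q))                   ≡⟨ ℚ.fromℚᵘ-cong (ℚᵘ.≃-trans (ℚ.toℚᵘ-homo-* p q)
                                               (ℚᵘ.*-cong (ℚ.toℚᵘ-fromℚᵘ (mkℚᵘ (+ x) b)) (ℚ.toℚᵘ-fromℚᵘ (mkℚᵘ (+ y) d)))) ⟩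
  (+ x ℤ.* + y) / (suc b ℕ.* suc d)       ≡⟨ ℚ./-cong (ℤ.pos-* x y) refl ⟨
  (x ℕ.* y) ÷ℕ (suc b ℕ.* suc d)          ∎
  where
  open ≡-Reasoning
  p = x ÷ℕ suc b
  q = y ÷ℕ suc d

÷ℕ-+ : ∀ x y b d → (x ÷ℕ suc b) + (y ÷ℕ suc d) ≡ (x ℕ.* suc d ℕ.+ y ℕ.* suc b) ÷ℕ (suc b ℕ.* suc d)
÷ℕ-+ x y b d = begin
  p + q                                                   ≡⟨ ℚ.fromℚᵘ-toℚᵘ (p + q) ⟨
  fromℚᵘ (toℚᵘ (p + q))                                   ≡⟨ ℚ.fromℚᵘ-cong (ℚᵘ.≃-trans (ℚ.toℚᵘ-homo-+ p q)
                                                               (ℚᵘ.+-cong (ℚ.toℚᵘ-fromℚᵘ (mkℚᵘ (+ x) b)) (ℚ.toℚᵘ-fromℚᵘ (mkℚᵘ (+ y) d)))) ⟩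
  (+ x ℤ.* + suc d ℤ.+ + y ℤ.* + suc b) / (suc b ℕ.* suc d) ≡⟨ ℚ./-cong numerators refl ⟨
  (x ℕ.* suc d ℕ.+ y ℕ.* suc b) ÷ℕ (suc b ℕ.* suc d)      ∎
  where
  open ≡-Reasoning
  p = x ÷ℕ suc b
  q = y ÷ℕ suc d
  numerators : + (x ℕ.* suc d ℕ.+ y ℕ.* suc b) ≡ + x ℤ.* + suc d ℤ.+ + y ℤ.* + suc b
  numerators = trans (ℤ.pos-+ (x ℕ.* suc d) (y ℕ.* suc b))
                     (cong₂ ℤ._+_ (ℤ.pos-* x (suc d)) (ℤ.pos-* y (suc b)))

ℕ→ℚ-+ : ∀ a b → ℕ→ℚ (a ℕ.+ b) ≡ ℕ→ℚ a + ℕ→ℚ b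
ℕ→ℚ-+ a b = begin
  ℕ→ℚ (a ℕ.+ b)                  ≡⟨ cong (_÷ℕ 1) (cong₂ ℕ._+_ (ℕ.*-identityʳ a) (ℕ.*-identityʳ b)) ⟨
  (a ℕ.* 1 ℕ.+ b ℕ.* 1) ÷ℕ 1     ≡⟨ ÷ℕ-+ a b 0 0 ⟨
  ℕ→ℚ a + ℕ→ℚ b                  ∎
  where open ≡-Reasoning

ℕ→ℚ-* : ∀ a b → ℕ→ℚ (a ℕ.* b) ≡ ℕ→ℚ a * ℕ→ℚ b
ℕ→ℚ-* a b = sym (÷ℕ-* a b 0 0)

*-÷ℕ : ∀ a x D → (a ℕ.* x) ÷ℕ D ≡ ℕ→ℚ a * (x ÷ℕ D)
*-÷ℕ a x zero    = sym (ℚ.*-zeroʳ (ℕ→ℚ a))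
*-÷ℕ a x (suc d) = sym (trans (÷ℕ-* a x 0 d) (cong ((a ℕ.* x) ÷ℕ_) (ℕ.*-identityˡ (suc d))))

÷ℕ-cancelˡ : ∀ k x D → (suc k ℕ.* x) ÷ℕ (suc k ℕ.* D) ≡ x ÷ℕ D
÷ℕ-cancelˡ k x zero    rewrite ℕ.*-zeroʳ k = refl
÷ℕ-cancelˡ k x (suc d) = ÷ℕ-cross {suc k ℕ.* x} {x} {d ℕ.+ k ℕ.* suc d} {d} (begin
  suc k ℕ.* x ℕ.* suc d    ≡⟨ cong (ℕ._* suc d) (ℕ.*-comm (suc k) x) ⟩
  x ℕ.* suc k ℕ.* suc d    ≡⟨ ℕ.*-assoc x (suc k) (suc d) ⟩
  x ℕ.* (suc k ℕ.* suc d)  ∎)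
  where open ≡-Reasoning

÷ℕ-nonNeg : ∀ x D → NonNegative (x ÷ℕ D)
÷ℕ-nonNeg x zero    = _
÷ℕ-nonNeg x (suc d) = ℚ.normalize-nonNeg x (suc d)

term-nonNeg : ∀ n λs → NonNegative (term n λs)
term-nonNeg n λs = ÷ℕ-nonNeg ((n ℕ.∸ 1) !) (tailProd n λs ℕ.* prodℕ (map (λ l → (l ℕ.∸ 1) !) λs))

-- the factor 1 is (k ∸ 1)! for the deleted leading part k ∈ {1, 2}
leading-denominator : ∀ m T P → (m ℕ.* T) ℕ.* (1 ℕ.* P) ≡ m ℕ.* (T ℕ.* P)
leading-denominator m T P = trans (cong ((m ℕ.* T) ℕ.*_) (ℕ.*-identityˡ P)) (ℕ.*-assoc m T P)

term-1∷ : ∀ s l ls → term (suc (suc s)) (1 ∷ l ∷ ls) ≡ term (suc s) (l ∷ ls)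
term-1∷ s l ls = begin
  (suc s ℕ.* s !) ÷ℕ ((suc s ℕ.* T) ℕ.* (1 ℕ.* P))  ≡⟨ cong ((suc s ℕ.* s !) ÷ℕ_) (leading-denominator (suc s) T P) ⟩
  (suc s ℕ.* s !) ÷ℕ (suc s ℕ.* (T ℕ.* P))          ≡⟨ ÷ℕ-cancelˡ s (s !) (T ℕ.* P) ⟩
  term (suc s) (l ∷ ls)                            ∎
  where
  open ≡-Reasoning
  T = tailProd (suc s) (l ∷ ls)
  P = prodℕ (map (λ l → (l ℕ.∸ 1) !) (l ∷ ls))

term-2∷ : ∀ r l ls → term (suc (suc (suc r))) (2 ∷ l ∷ ls) ≡ ℕ→ℚ (suc (suc r)) * term (suc r) (l ∷ ls)
term-2∷ r l ls = begin
  (suc (suc r) ℕ.* (suc r) !) ÷ℕ ((suc r ℕ.* T) ℕ.* (1 ℕ.* P))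
    ≡⟨ cong ((suc (suc r) ℕ.* (suc r) !) ÷ℕ_) (leading-denominator (suc r) T P) ⟩
  (suc (suc r) ℕ.* (suc r) !) ÷ℕ (suc r ℕ.* (T ℕ.* P))
    ≡⟨ *-÷ℕ (suc (suc r)) ((suc r) !) (suc r ℕ.* (T ℕ.* P)) ⟩
  ℕ→ℚ (suc (suc r)) * ((suc r ℕ.* r !) ÷ℕ (suc r ℕ.* (T ℕ.* P)))
    ≡⟨ cong (ℕ→ℚ (suc (suc r)) *_) (÷ℕ-cancelˡ r (r !) (T ℕ.* P)) ⟩
  ℕ→ℚ (suc (suc r)) * term (suc r) (l ∷ ls)
    ∎
  where
  open ≡-Reasoning
  T = tailProd (suc r) (l ∷ ls)
  P = prodℕ (map (λ l → (l ℕ.∸ 1) !) (l ∷ ls))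

data NonEmpty {A : Set} : List A → Set where
  cons : ∀ x xs → NonEmpty (x ∷ xs)

compsF-nonEmpty : ∀ f r → All NonEmpty (compsF f (suc r))
compsF-nonEmpty zero    r = []
compsF-nonEmpty (suc f) r =
  concat⁺ (map⁺ (universal (λ k → map⁺ (universal (cons k) (compsF f (suc r ℕ.∸ k)))) (oneTo (suc r))))

compsF-split : ∀ f r → ∃[ R ] compsF (suc f) (suc (suc (suc r)))
             ≡ map (1 ∷_) (compsF f (suc (suc r))) ++ map (2 ∷_) (compsF f (suc r)) ++ R
compsF-split f r = _ , refl

sq-nonNeg : ∀ p → .{{_ : NonNegative p}} → NonNegative (sq p)
sq-nonNeg p = ℚ.nonNeg*nonNeg⇒nonNeg p p

sqSum : ℕ → List (List ℕ) → ℚ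
sqSum n cs = sumℚ (map (λ λs → sq (term n λs)) cs)

sumℚ-++ : ∀ xs ys → sumℚ (xs ++ ys) ≡ sumℚ xs + sumℚ ys
sumℚ-++ []       ys = sym (ℚ.+-identityˡ (sumℚ ys))
sumℚ-++ (x ∷ xs) ys = trans (cong (λ s → x + s) (sumℚ-++ xs ys)) (sym (ℚ.+-assoc x (sumℚ xs) (sumℚ ys)))

sqSum-++ : ∀ n cs ds → sqSum n (cs ++ ds) ≡ sqSum n cs + sqSum n ds
sqSum-++ n cs ds = trans (cong sumℚ (map-++ sqTerm cs ds)) (sumℚ-++ (map sqTerm cs) (map sqTerm ds))
  where
  sqTerm : List ℕ → ℚ
  sqTerm λs = sq (term n λs)

sqSum-nonNeg : ∀ n cs → 0ℚ ≤ sqSum n cs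
sqSum-nonNeg n []        = ℚ.≤-refl
sqSum-nonNeg n (λs ∷ cs) = ℚ.+-mono-≤ (ℚ.nonNegative⁻¹ (sq t) {{sq-nonNeg t {{term-nonNeg n λs}}}}) (sqSum-nonNeg n cs)
  where t = term n λs

sqSum-≤-++ : ∀ n cs ds → sqSum n cs ≤ sqSum n (cs ++ ds)
sqSum-≤-++ n cs ds = begin
  sqSum n cs                ≡⟨ ℚ.+-identityʳ (sqSum n cs) ⟨
  sqSum n cs + 0ℚ           ≤⟨ ℚ.+-monoʳ-≤ (sqSum n cs) (sqSum-nonNeg n ds) ⟩
  sqSum n cs + sqSum n ds   ≡⟨ sqSum-++ n cs ds ⟨
  sqSum n (cs ++ ds)        ∎
  where open ℚ.≤-Reasoning

sqSum-map-1∷ : ∀ s {cs} → All NonEmpty cs → sqSum (suc (suc s)) (map (1 ∷_) cs) ≡ sqSum (suc s) cs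
sqSum-map-1∷ s []               = refl
sqSum-map-1∷ s (cons l ls ∷ ne) = cong₂ _+_ (cong sq (term-1∷ s l ls)) (sqSum-map-1∷ s ne)

sq-* : ∀ p q → sq (p * q) ≡ (p * p) * sq q
sq-* p q = interchange p q p q

sqSum-map-2∷ : ∀ r {cs} → All NonEmpty cs → let c = ℕ→ℚ (suc (suc r)) in
  sqSum (suc (suc (suc r))) (map (2 ∷_) cs) ≡ (c * c) * sqSum (suc r) cs
sqSum-map-2∷ r []                        = sym (ℚ.*-zeroʳ (ℕ→ℚ (suc (suc r)) * ℕ→ℚ (suc (suc r))))
sqSum-map-2∷ r {λs ∷ cs} (cons l ls ∷ ne) = begin
  sq (term (suc (suc (suc r))) (2 ∷ l ∷ ls)) + sqSum (suc (suc (suc r))) (map (2 ∷_) cs)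
    ≡⟨ cong₂ _+_ (trans (cong sq (term-2∷ r l ls)) (sq-* c (term (suc r) λs))) (sqSum-map-2∷ r ne) ⟩
  (c * c) * sq (term (suc r) λs) + (c * c) * sqSum (suc r) cs
    ≡⟨ ℚ.*-distribˡ-+ (c * c) _ _ ⟨
  (c * c) * sqSum (suc r) (λs ∷ cs)
    ∎
  where
  open ≡-Reasoning
  c = ℕ→ℚ (suc (suc r))

sqSum-recurrence : ∀ f r → let c = ℕ→ℚ (suc (suc r)) in
  sqSum (suc (suc r)) (compsF f (suc (suc r))) + (c * c) * sqSum (suc r) (compsF f (suc r))
  ≤ sqSum (suc (suc (suc r))) (compsF (suc f) (suc (suc (suc r))))
sqSum-recurrence f r with compsF-split f r
... | R , split rewrite split = begin
  sqSum (suc (suc r)) (compsF f (suc (suc r))) + (c * c) * sqSum (suc r) (compsF f (suc r))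
    ≡⟨ cong₂ _+_ (sqSum-map-1∷ (suc r) (compsF-nonEmpty f (suc r))) (sqSum-map-2∷ r (compsF-nonEmpty f r)) ⟨
  sqSum n ones + sqSum n twos
    ≤⟨ ℚ.+-monoʳ-≤ (sqSum n ones) (sqSum-≤-++ n twos R) ⟩
  sqSum n ones + sqSum n (twos ++ R)
    ≡⟨ sqSum-++ n ones (twos ++ R) ⟨
  sqSum n (ones ++ twos ++ R)
    ∎
  where
  open ℚ.≤-Reasoning
  n = suc (suc (suc r))
  c = ℕ→ℚ (suc (suc r))
  ones = map (1 ∷_) (compsF f (suc (suc r)))
  twos = map (2 ∷_) (compsF f (suc r))

!-recurrence : ∀ n → suc (suc n) ! ≡ suc n ! ℕ.+ (suc n ℕ.* suc n) ℕ.* n !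
!-recurrence n = cong (suc n ! ℕ.+_) (sym (ℕ.*-assoc (suc n) (suc n) (n !)))

ℕ→ℚ-!-recurrence : ∀ n → let c = ℕ→ℚ (suc n) in
  ℕ→ℚ (suc (suc n) !) ≡ ℕ→ℚ (suc n !) + (c * c) * ℕ→ℚ (n !)
ℕ→ℚ-!-recurrence n = begin
  ℕ→ℚ (suc (suc n) !)                                        ≡⟨ cong ℕ→ℚ (!-recurrence n) ⟩
  ℕ→ℚ (suc n ! ℕ.+ (suc n ℕ.* suc n) ℕ.* n !)               ≡⟨ ℕ→ℚ-+ (suc n !) _ ⟩
  ℕ→ℚ (suc n !) + ℕ→ℚ ((suc n ℕ.* suc n) ℕ.* n !)          ≡⟨ cong (λ q → ℕ→ℚ (suc n !) + q) c²·n! ⟩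
  ℕ→ℚ (suc n !) + (ℕ→ℚ (suc n) * ℕ→ℚ (suc n)) * ℕ→ℚ (n !)  ∎
  where
  open ≡-Reasoning
  c²·n! : ℕ→ℚ ((suc n ℕ.* suc n) ℕ.* n !) ≡ (ℕ→ℚ (suc n) * ℕ→ℚ (suc n)) * ℕ→ℚ (n !)
  c²·n! = trans (ℕ→ℚ-* (suc n ℕ.* suc n) (n !)) (cong (_* ℕ→ℚ (n !)) (ℕ→ℚ-* (suc n) (suc n)))

factorial-≤-sqSum : ∀ f m → m ℕ.≤ f → ℕ→ℚ (m !) ≤ sqSum m (compsF f m)
factorial-≤-sqSum f              zero                _       = ℚ.≤-refl
factorial-≤-sqSum (suc f)        (suc zero)          _       = ℚ.≤-refl
factorial-≤-sqSum (suc (suc f))  (suc (suc zero))    _       = ℚ.≤-refl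
factorial-≤-sqSum (suc f)        (suc (suc (suc r))) (s≤s m≤f) = begin
  ℕ→ℚ (suc (suc (suc r)) !)
    ≡⟨ ℕ→ℚ-!-recurrence (suc r) ⟩
  ℕ→ℚ (suc (suc r) !) + (c * c) * ℕ→ℚ (suc r !)
    ≤⟨ ℚ.+-mono-≤ (factorial-≤-sqSum f (suc (suc r)) m≤f)
                  (ℚ.*-monoˡ-≤-nonNeg (c * c) {{sq-nonNeg c {{÷ℕ-nonNeg (suc (suc r)) 1}}}}
                    (factorial-≤-sqSum f (suc r) (ℕ.m+n≤o⇒n≤o 1 m≤f))) ⟩
  sqSum (suc (suc r)) (compsF f (suc (suc r))) + (c * c) * sqSum (suc r) (compsF f (suc r))
    ≤⟨ sqSum-recurrence f r ⟩
  sqSum (suc (suc (suc r))) (compsF (suc f) (suc (suc (suc r))))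
    ∎
  where
  open ℚ.≤-Reasoning
  c = ℕ→ℚ (suc (suc r))

proposition5p5 : (n : ℕ) → ℕ→ℚ ((suc n) !) ≤ RHS (suc n)
proposition5p5 n = factorial-≤-sqSum (suc n) (suc n) ℕ.≤-refl
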